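{- Let $G=(V,E)$ be a finite connected undirected multigraph without self-loops, let $\eta^*$ be the optimal density for $\mathrm{Mod}_2(\Phi)$, let $E_{\max}=\{e\in E:\eta^*(e)=\max_{e'\in E}\eta^*(e')\}$, and let $P_{\max}$ be a Beurling partition of $G$ with cut set $E_{P_{\max}}=E_{\max}$ (such a partition exists). Then the shrunk graph $G_{P_{\max}}$ is homogeneous.
   Context: A feasible partition of $V$ is a partition $P=\{V_1,\dots,V_{k_P}\}$, $k_P\ge2$, with each induced subgraph $G(V_i)$ connected; its cut set $E_P$ is the set of edges joining different parts; the shrunk graph $G_P$ is obtained by identifying each $V_i$ to a single vertex and deleting self-loops (edge set $E_P$). $\Phi$ is the family of feasible partitions with usage vectors $\frac{1}{k_P-1}\mathbb{1}_{E_P}$; for a finite family $\mathcal{F}$ of usage vectors, $\mathrm{Adm}(\mathcal{F})=\{\rho\ge0:\sum_e u(e)\rho(e)\ge1\ \forall u\in\mathcal{F}\}$ and $\mathrm{Mod}_2(\mathcal{F})=\min_{\rho\in\mathrm{Adm}(\mathcal{F})}\sum_e\rho(e)^2$, with unique minimizer; $\eta^*$ is the minimizer for $\mathrm{Mod}_2(\Phi)$. $P$ is Beurling if $\sum_{e\in E_P}\eta^*(e)=k_P-1$. A graph $H$ is homogeneous if the unique optimal density for $\mathrm{Mod}_2(\Gamma_H)$ is constant on the edges of $H$, where $\Gamma_H$ is the family of spanning trees of $H$ with indicator usage vectors.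
   Formalization: The optimal density η* for $\mathrm{Mod}_2(\Phi)$, the optimal densities for $\mathrm{Mod}_2(\Gamma_H)$, and the admissible densities they are compared with all take values in ℚ. -}

module Defs where

open import Data.Nat using (ℕ; zero; suc)
open import Data.Fin using (Fin; zero; suc; _≟_)
open import Data.Bool using (Bool; true; false; not; if_then_else_)
open import Data.Product using (Σ; _×_; _,_; proj₁; proj₂)
open import Data.Unit using (⊤)
open import Data.List using (List; length; filterᵇ; lookup; allFin)
open import Data.Integer using (+_)
open import Data.Rational using (ℚ; _+_; _*_; _≤_; _/_; 0ℚ; 1ℚ)
open import Relation.Nullary using (¬_; does)
open import Relation.Binary.PropositionalEquality using (_≡_; _≢_)

-- A finite undirected multigraph: vertices Fin n, edges Fin m,
-- each edge has an (unordered; the order is irrelevant below) pair of endpoints.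
record Graph : Set where
  field
    n    : ℕ
    m    : ℕ
    ends : Fin m → Fin n × Fin n
open Graph public

NoSelfLoops : Graph → Set
NoSelfLoops G = ∀ e → proj₁ (ends G e) ≢ proj₂ (ends G e)

data Reach (G : Graph) (S : Fin (m G) → Set) : Fin (n G) → Fin (n G) → Set where
  here : ∀ {u} → Reach G S u u
  fwd  : ∀ {u v} e → S e → proj₁ (ends G e) ≡ u → Reach G S (proj₂ (ends G e)) v → Reach G S u v
  bwd  : ∀ {u v} e → S e → proj₂ (ends G e) ≡ u → Reach G S (proj₁ (ends G e)) v → Reach G S u v

ConnectedVia : (G : Graph) → (Fin (m G) → Set) → Set
ConnectedVia G S = ∀ u v → Reach G S u v

AllEdges : {G : Graph} → Fin (m G) → Set
AllEdges _ = ⊤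

Connected : Graph → Set
Connected G = ConnectedVia G (AllEdges {G})

sumFin : {m : ℕ} → (Fin m → ℚ) → ℚ
sumFin {zero}  f = 0ℚ
sumFin {suc m} f = f zero + sumFin {m} (λ i → f (suc i))

fromℕ : ℕ → ℚ
fromℕ k = + k / 1

record Family (m : ℕ) : Set₁ where
  field
    Index : Set
    usage : Index → Fin m → ℚ
open Family public

Adm : {m : ℕ} → Family m → (Fin m → ℚ) → Set
Adm F ρ = (∀ e → 0ℚ ≤ ρ e) × (∀ γ → 1ℚ ≤ sumFin (λ e → usage F γ e * ρ e))

energy : {m : ℕ} → (Fin m → ℚ) → ℚ
energy ρ = sumFin (λ e → ρ e * ρ e)

IsOptimal : {m : ℕ} → Family m → (Fin m → ℚ) → Set
IsOptimal F ρ = Adm F ρ × (∀ ρ' → Adm F ρ' → energy ρ ≤ energy ρ')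

InSet : {m : ℕ} → (Fin m → Bool) → Fin m → Set
InSet T e = T e ≡ true

InSetMinus : {m : ℕ} → (Fin m → Bool) → Fin m → Fin m → Set
InSetMinus T e f = (T f ≡ true) × (f ≢ e)

IsSpanningTree : (G : Graph) → (Fin (m G) → Bool) → Set
IsSpanningTree G T =
  ConnectedVia G (InSet T) × (∀ e → T e ≡ true → ¬ ConnectedVia G (InSetMinus T e))

indicator : {m : ℕ} → (Fin m → Bool) → Fin m → ℚ
indicator T e = if T e then 1ℚ else 0ℚ

SpanningTrees : (G : Graph) → Family (m G)
SpanningTrees G = record
  { Index = Σ (Fin (m G) → Bool) (IsSpanningTree G)
  ; usage = λ T → indicator (proj₁ T) }

Homogeneous : Graph → Set
Homogeneous H = ∀ ρ → IsOptimal (SpanningTrees H) ρ → ∀ e e' → ρ e ≡ ρ e'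

-- Feasible partitions.  A partition into k = suc (suc j) ≥ 2 parts is a
-- surjective labelling part : Fin n → Fin k; the parts V_i are the fibres.

record Partition (G : Graph) : Set where
  field
    j    : ℕ
    part : Fin (n G) → Fin (suc (suc j))
open Partition public

kP : {G : Graph} → Partition G → ℕ
kP P = suc (suc (j P))

Surjective : {G : Graph} → Partition G → Set
Surjective {G} P = ∀ (i : Fin (kP {G} P)) → Σ (Fin (n G)) (λ v → part P v ≡ i)

Internal : {G : Graph} (P : Partition G) → Fin (kP {G} P) → Fin (m G) → Set
Internal {G} P i e = (part P (proj₁ (ends G e)) ≡ i) × (part P (proj₂ (ends G e)) ≡ i)

PartsConnected : {G : Graph} → Partition G → Set
PartsConnected {G} P = ∀ i u v → part P u ≡ i → part P v ≡ i → Reach G (Internal {G} P i) u v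

Feasible : {G : Graph} → Partition G → Set
Feasible {G} P = Surjective {G} P × PartsConnected {G} P

isCut : {G : Graph} → Partition G → Fin (m G) → Bool
isCut {G} P e = not (does (part P (proj₁ (ends G e)) ≟ part P (proj₂ (ends G e))))

InCut : {G : Graph} → Partition G → Fin (m G) → Set
InCut {G} P e = isCut {G} P e ≡ true

usageP : {G : Graph} → Partition G → Fin (m G) → ℚ
usageP {G} P e = if isCut {G} P e then (+ 1 / suc (j P)) else 0ℚ

Φ : (G : Graph) → Family (m G)
Φ G = record
  { Index = Σ (Partition G) (Feasible {G})
  ; usage = λ P → usageP {G} (proj₁ P) }

Beurling : {G : Graph} → (Fin (m G) → ℚ) → Partition G → Set
Beurling {G} η P = sumFin (λ e → if isCut {G} P e then η e else 0ℚ) ≡ fromℕ (suc (j P))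

InEmax : {G : Graph} → (Fin (m G) → ℚ) → Fin (m G) → Set
InEmax {G} η e = ∀ e' → η e' ≤ η e

-- The shrunk graph G_P: vertices = parts, edges = E_P (listed in increasing order).
cutList : {G : Graph} → Partition G → List (Fin (m G))
cutList {G} P = filterᵇ (isCut {G} P) (allFin (m G))

shrink : (G : Graph) → Partition G → Graph
shrink G P = record
  { n    = kP {G} P
  ; m    = length (cutList {G} P)
  ; ends = λ i → let e = lookup (cutList {G} P) i in
                 (part P (proj₁ (ends G e)) , part P (proj₂ (ends G e))) }

{-# OPTIONS --safe #-}
module Submission where

-- Let M be the maximum of η*.  Every edge of H = G_P is a cut edge of P, so η* ≡ M on H.
-- Pulling a feasible partition Q of H back to G yields a feasible partition of G with the
-- same cut set, so Φ-admissibility of η* says that the constant density M is Φ-admissible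
-- on H:  k_Q - 1 ≤ M |E_Q|.  The Beurling property of P says M |E_H| = |V_H| - 1.
-- A Kruskal-type greedy argument (repeatedly merge the two classes joined by the lightest
-- crossing edge) turns these partition inequalities into: for every ρ ≥ 0 some spanning
-- tree T has ρ(T) ≤ M ρ(E_H), so every Γ_H-admissible ρ has M ρ(E_H) ≥ 1.  As spanning
-- trees have at least |V_H| - 1 edges, u = 1/(|V_H| - 1) is Γ_H-admissible; writing
-- U = u² |E_H| for its energy, U ≤ U · M ρ(E_H) = u ρ(E_H), hence for the optimal ρ
--   Σ (ρ - u)² = energy ρ - 2u ρ(E_H) + U ≤ 2 (U - u ρ(E_H)) ≤ 0,   i.e. ρ ≡ u.

open import Defs
open import Data.Product using (_×_)
open import Data.Fin using (Fin)
open import Data.Rational using (ℚ)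

open import Data.Bool using (Bool; true; false; not; if_then_else_; T?)
open import Data.Bool.Properties using (T-≡; ¬-not)
open import Data.Empty using (⊥-elim)
open import Data.Fin using (zero; suc; _≟_; punchOut; punchIn)
import Data.Fin.Properties as Finₚ
import Data.Integer as ℤ
import Data.Integer.Tactic.RingSolver as ℤ-Solver
open import Data.List using (List; filterᵇ; lookup; allFin; tabulate)
open import Data.List.Membership.Propositional using (_∈_)
open import Data.List.Membership.Propositional.Properties using (∈-filter⁺; ∈-filter⁻; ∈-allFin; ∈-lookup)
import Data.List.Relation.Unary.All as All
open import Data.List.Relation.Unary.Any using (index)
open import Data.List.Relation.Unary.Any.Properties using (lookup-index)
open import Data.Nat using (ℕ; zero; suc; pred; NonZero)
open import Data.Product using (Σ; _,_; proj₁; proj₂)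
open import Data.Rational
  using (_+_; _*_; _-_; -_; _≤_; _<_; _/_; 0ℚ; 1ℚ; toℚᵘ; nonNegative; negative; positive)
import Data.Rational.Properties as ℚ
open import Data.Rational.Unnormalised as ℚᵘ using (mkℚᵘ; *≡*)
import Data.Rational.Unnormalised.Properties as ℚᵘ
open import Data.Sum using (_⊎_; inj₁; inj₂)
open import Function using (_∘_)
open import Function.Bundles using (Equivalence)
open import Level using (0ℓ)
open import Relation.Binary.Bundles using (DecTotalOrder)
open import Relation.Binary.Definitions using (tri<; tri≈; tri>)
open import Relation.Binary.PropositionalEquality
import Relation.Binary.Reasoning.Setoid as SetoidReasoning
open import Relation.Nullary using (¬_; Dec; yes; no; does)
open import Relation.Nullary.Decidable using (dec⇒maybe)
open import Tactic.RingSolver using (solve-∀)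
import Tactic.RingSolver.Core.AlmostCommutativeRing as ACR

open import Data.List.Extrema (DecTotalOrder.totalOrder ℚ.≤-decTotalOrder)
  using (argmin; argmin-all; f[argmin]≤f[xs])

ℚ-ring : ACR.AlmostCommutativeRing 0ℓ 0ℓ
ℚ-ring = ACR.fromCommutativeRing ℚ.+-*-commutativeRing (λ p → dec⇒maybe (0ℚ ℚ.≟ p))

-- fromℕ k = + k / 1 goes through gcd normalisation, so identities about it are checked on
-- unnormalised representatives.
toℚᵘ-fromℕ : ∀ k → toℚᵘ (fromℕ k) ℚᵘ.≃ mkℚᵘ (ℤ.+ k) 0
toℚᵘ-fromℕ k = ℚ.toℚᵘ-fromℚᵘ (mkℚᵘ (ℤ.+ k) 0)

fromℕ-suc : ∀ k → fromℕ (suc k) ≡ 1ℚ + fromℕ k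
fromℕ-suc k = ℚ.toℚᵘ-injective (begin
  toℚᵘ (fromℕ (suc k))             ≈⟨ toℚᵘ-fromℕ (suc k) ⟩
  mkℚᵘ (ℤ.+ suc k) 0               ≈⟨ *≡* (cross-multiplied (ℤ.+ k)) ⟩
  toℚᵘ 1ℚ ℚᵘ.+ mkℚᵘ (ℤ.+ k) 0      ≈⟨ ℚᵘ.+-congʳ (toℚᵘ 1ℚ) (toℚᵘ-fromℕ k) ⟨
  toℚᵘ 1ℚ ℚᵘ.+ toℚᵘ (fromℕ k)      ≈⟨ ℚ.toℚᵘ-homo-+ 1ℚ (fromℕ k) ⟨
  toℚᵘ (1ℚ + fromℕ k)              ∎)
  where
  open SetoidReasoning ℚᵘ.≃-setoid
  cross-multiplied : ∀ x →
    (ℤ.1ℤ ℤ.+ x) ℤ.* (ℤ.1ℤ ℤ.* ℤ.1ℤ) ≡ (ℤ.1ℤ ℤ.* ℤ.1ℤ ℤ.+ x ℤ.* ℤ.1ℤ) ℤ.* ℤ.1ℤ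
  cross-multiplied = ℤ-Solver.solve-∀

1/k*k≡1 : ∀ k .{{_ : NonZero k}} → (ℤ.+ 1 / k) * fromℕ k ≡ 1ℚ
1/k*k≡1 (suc k) = ℚ.toℚᵘ-injective (begin
  toℚᵘ (1/k * fromℕ (suc k))              ≈⟨ ℚ.toℚᵘ-homo-* 1/k (fromℕ (suc k)) ⟩
  toℚᵘ 1/k ℚᵘ.* toℚᵘ (fromℕ (suc k))      ≈⟨ ℚᵘ.*-cong (ℚ.toℚᵘ-fromℚᵘ (mkℚᵘ (ℤ.+ 1) k)) (toℚᵘ-fromℕ (suc k)) ⟩
  mkℚᵘ (ℤ.+ 1) k ℚᵘ.* mkℚᵘ (ℤ.+ suc k) 0  ≈⟨ *≡* (cross-multiplied (ℤ.+ suc k)) ⟩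
  toℚᵘ 1ℚ                                 ∎)
  where
  open SetoidReasoning ℚᵘ.≃-setoid
  1/k : ℚ
  1/k = ℤ.+ 1 / suc k
  cross-multiplied : ∀ x → (ℤ.1ℤ ℤ.* x) ℤ.* ℤ.1ℤ ≡ ℤ.1ℤ ℤ.* (x ℤ.* ℤ.1ℤ)
  cross-multiplied = ℤ-Solver.solve-∀

0≤fromℕ : ∀ k → 0ℚ ≤ fromℕ k
0≤fromℕ k = ℚ.nonNegative⁻¹ (fromℕ k) {{ℚ.normalize-nonNeg k 1}}

0≤1/k : ∀ k .{{_ : NonZero k}} → 0ℚ ≤ ℤ.+ 1 / k
0≤1/k k = ℚ.nonNegative⁻¹ (ℤ.+ 1 / k) {{ℚ.normalize-nonNeg 1 k}}

*-monoˡ-≤-0≤ : ∀ {r p q} → 0ℚ ≤ r → p ≤ q → r * p ≤ r * q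
*-monoˡ-≤-0≤ {r} 0≤r = ℚ.*-monoˡ-≤-nonNeg r {{nonNegative 0≤r}}

0≤p*q : ∀ {p q} → 0ℚ ≤ p → 0ℚ ≤ q → 0ℚ ≤ p * q
0≤p*q {p} {q} 0≤p 0≤q =
  ℚ.nonNegative⁻¹ (p * q) {{ℚ.nonNeg*nonNeg⇒nonNeg p {{nonNegative 0≤p}} q {{nonNegative 0≤q}}}}

p≤q⇒0≤q-p : ∀ {p q} → p ≤ q → 0ℚ ≤ q - p
p≤q⇒0≤q-p {p} {q} p≤q = begin
  0ℚ      ≡⟨ ℚ.+-inverseʳ p ⟨
  p - p   ≤⟨ ℚ.+-monoˡ-≤ (- p) p≤q ⟩
  q - p   ∎
  where open ℚ.≤-Reasoning

<⇒≱ : ∀ {p q} → p < q → ¬ (q ≤ p)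
<⇒≱ p<q q≤p = ℚ.<-irrefl refl (ℚ.<-≤-trans p<q q≤p)

p+1≰p : ∀ p → ¬ (p + 1ℚ ≤ p)
p+1≰p p = <⇒≱ (begin-strict
  p         ≡⟨ ℚ.+-identityʳ p ⟨
  p + 0ℚ    <⟨ ℚ.+-monoʳ-< p (ℚ.positive⁻¹ 1ℚ) ⟩
  p + 1ℚ    ∎)
  where open ℚ.≤-Reasoning

0<x*x : ∀ x → x ≢ 0ℚ → 0ℚ < x * x
0<x*x x x≢0 with ℚ.<-cmp x 0ℚ
... | tri< x<0 _ _ = ℚ.positive⁻¹ (x * x) {{ℚ.neg*neg⇒pos x {{negative x<0}} x {{negative x<0}}}}
... | tri≈ _ x≡0 _ = ⊥-elim (x≢0 x≡0)
... | tri> _ _ x>0 = ℚ.positive⁻¹ (x * x) {{ℚ.pos*pos⇒pos x {{positive x>0}} x {{positive x>0}}}}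

0≤x*x : ∀ x → 0ℚ ≤ x * x
0≤x*x x with x ℚ.≟ 0ℚ
... | yes refl = ℚ.≤-refl
... | no  x≢0 = ℚ.<⇒≤ (0<x*x x x≢0)

x*x≤0⇒x≡0 : ∀ x → x * x ≤ 0ℚ → x ≡ 0ℚ
x*x≤0⇒x≡0 x x*x≤0 with x ℚ.≟ 0ℚ
... | yes x≡0 = x≡0
... | no  x≢0 = ⊥-elim (<⇒≱ (0<x*x x x≢0) x*x≤0)

sumFin-cong : ∀ {m} {f g : Fin m → ℚ} → (∀ e → f e ≡ g e) → sumFin f ≡ sumFin g
sumFin-cong {zero}  f≗g = refl
sumFin-cong {suc m} f≗g = cong₂ _+_ (f≗g zero) (sumFin-cong (f≗g ∘ suc))

sumFin-mono-≤ : ∀ {m} {f g : Fin m → ℚ} → (∀ e → f e ≤ g e) → sumFin f ≤ sumFin g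
sumFin-mono-≤ {zero}  f≤g = ℚ.≤-refl
sumFin-mono-≤ {suc m} f≤g = ℚ.+-mono-≤ (f≤g zero) (sumFin-mono-≤ (f≤g ∘ suc))

sumFin-+ : ∀ {m} (f g : Fin m → ℚ) → sumFin (λ e → f e + g e) ≡ sumFin f + sumFin g
sumFin-+ {zero}  f g = refl
sumFin-+ {suc m} f g = begin
  (f zero + g zero) + sumFin (λ e → f (suc e) + g (suc e))  ≡⟨ cong ((f zero + g zero) +_) (sumFin-+ (f ∘ suc) (g ∘ suc)) ⟩
  (f zero + g zero) + (sumFin (f ∘ suc) + sumFin (g ∘ suc))  ≡⟨ interchange (f zero) (g zero) _ _ ⟩
  (f zero + sumFin (f ∘ suc)) + (g zero + sumFin (g ∘ suc))  ∎
  where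
  open ≡-Reasoning
  interchange : ∀ a b c d → (a + b) + (c + d) ≡ (a + c) + (b + d)
  interchange = solve-∀ ℚ-ring

sumFin-* : ∀ {m} (a : ℚ) (f : Fin m → ℚ) → sumFin (λ e → a * f e) ≡ a * sumFin f
sumFin-* {zero}  a f = sym (ℚ.*-zeroʳ a)
sumFin-* {suc m} a f = trans (cong (a * f zero +_) (sumFin-* a (f ∘ suc))) (sym (ℚ.*-distribˡ-+ a (f zero) _))

sumFin-zero : ∀ {m} → sumFin {m} (λ _ → 0ℚ) ≡ 0ℚ
sumFin-zero {zero}  = refl
sumFin-zero {suc m} = trans (ℚ.+-identityˡ _) (sumFin-zero {m})

sumFin-nonNeg : ∀ {m} {f : Fin m → ℚ} → (∀ e → 0ℚ ≤ f e) → 0ℚ ≤ sumFin f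
sumFin-nonNeg {zero}  0≤f = ℚ.≤-refl
sumFin-nonNeg {suc m} 0≤f = ℚ.+-mono-≤ (0≤f zero) (sumFin-nonNeg (0≤f ∘ suc))

term≤sumFin : ∀ {m} {f : Fin m → ℚ} → (∀ e → 0ℚ ≤ f e) → ∀ e → f e ≤ sumFin f
term≤sumFin {suc m} {f} 0≤f zero = begin
  f zero                      ≡⟨ ℚ.+-identityʳ (f zero) ⟨
  f zero + 0ℚ                 ≤⟨ ℚ.+-monoʳ-≤ (f zero) (sumFin-nonNeg (0≤f ∘ suc)) ⟩
  f zero + sumFin (f ∘ suc)   ∎
  where open ℚ.≤-Reasoning
term≤sumFin {suc m} {f} 0≤f (suc e) = begin
  f (suc e)                   ≤⟨ term≤sumFin (0≤f ∘ suc) e ⟩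
  sumFin (f ∘ suc)            ≡⟨ ℚ.+-identityˡ _ ⟨
  0ℚ + sumFin (f ∘ suc)       ≤⟨ ℚ.+-monoˡ-≤ (sumFin (f ∘ suc)) (0≤f zero) ⟩
  f zero + sumFin (f ∘ suc)   ∎
  where open ℚ.≤-Reasoning

constant-of-energy≤ : ∀ {m} (ρ : Fin m → ℚ) (u : ℚ) →
  energy ρ ≤ energy {m} (λ _ → u) → energy {m} (λ _ → u) ≤ u * sumFin ρ → ∀ e → ρ e ≡ u
constant-of-energy≤ {m} ρ u E≤U U≤uR e = begin-equality
  ρ e             ≡⟨ shift (ρ e) u ⟩
  (ρ e - u) + u   ≡⟨ cong (_+ u) (x*x≤0⇒x≡0 (ρ e - u) (ℚ.≤-trans (term≤sumFin (λ f → 0≤x*x (ρ f - u)) e) D≤0)) ⟩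
  0ℚ + u          ≡⟨ ℚ.+-identityˡ u ⟩
  u               ∎
  where
  open ℚ.≤-Reasoning
  E U R D w : ℚ
  E = energy ρ
  U = energy {m} (λ _ → u)
  R = sumFin ρ
  D = sumFin (λ f → (ρ f - u) * (ρ f - u))
  w = - (u + u)
  shift : ∀ x u → x ≡ (x - u) + u
  shift = solve-∀ ℚ-ring
  expand : ∀ x u → (x - u) * (x - u) ≡ (x * x + (- (u + u)) * x) + u * u
  expand = solve-∀ ℚ-ring
  cancel : ∀ u R → u * R + (- (u + u)) * R + u * R ≡ 0ℚ
  cancel = solve-∀ ℚ-ring
  D≤0 : D ≤ 0ℚ
  D≤0 = begin
    D                                            ≡⟨ sumFin-cong (λ f → expand (ρ f) u) ⟩
    sumFin (λ f → (ρ f * ρ f + w * ρ f) + u * u)  ≡⟨ sumFin-+ (λ f → ρ f * ρ f + w * ρ f) (λ _ → u * u) ⟩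
    sumFin (λ f → ρ f * ρ f + w * ρ f) + U        ≡⟨ cong (_+ U) (sumFin-+ (λ f → ρ f * ρ f) (λ f → w * ρ f)) ⟩
    E + sumFin (λ f → w * ρ f) + U                ≡⟨ cong (λ x → E + x + U) (sumFin-* w ρ) ⟩
    E + w * R + U                                 ≤⟨ ℚ.+-mono-≤ (ℚ.+-monoˡ-≤ (w * R) (ℚ.≤-trans E≤U U≤uR)) U≤uR ⟩
    u * R + w * R + u * R                         ≡⟨ cancel u R ⟩
    0ℚ                                            ∎

when : Bool → ℚ → ℚ
when b x = if b then x else 0ℚ

weight : ∀ {m} → (Fin m → Bool) → (Fin m → ℚ) → ℚ
weight S ρ = sumFin (λ e → when (S e) (ρ e))

∣_∣ : ∀ {m} → (Fin m → Bool) → ℚ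
∣ S ∣ = weight S (λ _ → 1ℚ)

_∖[_] : ∀ {m} → (Fin m → Bool) → Fin m → Fin m → Bool
(S ∖[ e ]) f = if does (f ≟ e) then false else S f

insert : ∀ {m} → Fin m → (Fin m → Bool) → Fin m → Bool
insert e S f = if does (f ≟ e) then true else S f

∖[]-≢ : ∀ {m} (S : Fin m → Bool) {e f} → f ≢ e → (S ∖[ e ]) f ≡ S f
∖[]-≢ S {e} {f} f≢e with f ≟ e
... | yes f≡e = ⊥-elim (f≢e f≡e)
... | no  _   = refl

insert-self : ∀ {m} (S : Fin m → Bool) e → insert e S e ≡ true
insert-self S e with e ≟ e
... | yes _   = refl
... | no  e≢e = ⊥-elim (e≢e refl)

insert-⊇ : ∀ {m} (S : Fin m → Bool) e {f} → S f ≡ true → insert e S f ≡ true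
insert-⊇ S e {f} Sf with does (f ≟ e)
... | true  = refl
... | false = Sf

insert⁻ : ∀ {m} (S : Fin m → Bool) e {f} → insert e S f ≡ true → f ≡ e ⊎ S f ≡ true
insert⁻ S e {f} ins with f ≟ e
... | yes f≡e = inj₁ f≡e
... | no  _   = inj₂ ins

insert-∖[] : ∀ {m} (S : Fin m → Bool) {e} → S e ≡ false → ∀ f → (insert e S ∖[ e ]) f ≡ S f
insert-∖[] S {e} Se f with f ≟ e
... | yes refl = sym Se
... | no  _    = refl

0≤when : ∀ b {x} → (b ≡ true → 0ℚ ≤ x) → 0ℚ ≤ when b x
0≤when true  0≤x = 0≤x refl
0≤when false 0≤x = ℚ.≤-refl

when-mono-≤ : ∀ {s t x} → (s ≡ true → t ≡ true) → (t ≡ true → 0ℚ ≤ x) → when s x ≤ when t x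
when-mono-≤ {true}  {true}  _   _   = ℚ.≤-refl
when-mono-≤ {true}  {false} s⇒t _   with () ← s⇒t refl
when-mono-≤ {false} {t}     _   0≤x = 0≤when t 0≤x

when-1-* : ∀ b {x} → when b 1ℚ * x ≡ when b x
when-1-* true  {x} = ℚ.*-identityˡ x
when-1-* false {x} = ℚ.*-zeroˡ x

0≤∣_∣ : ∀ {m} (S : Fin m → Bool) → 0ℚ ≤ ∣ S ∣
0≤∣ S ∣ = sumFin-nonNeg (λ e → 0≤when (S e) (λ _ → ℚ.nonNegative⁻¹ 1ℚ))

weight-mono-⊆ : ∀ {m} {S T : Fin m → Bool} {ρ : Fin m → ℚ} → (∀ e → S e ≡ true → T e ≡ true) →
  (∀ e → T e ≡ true → 0ℚ ≤ ρ e) → weight S ρ ≤ weight T ρ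
weight-mono-⊆ S⊆T 0≤ρ = sumFin-mono-≤ (λ e → when-mono-≤ (S⊆T e) (0≤ρ e))

weight≤sumFin : ∀ {m} (S : Fin m → Bool) {ρ : Fin m → ℚ} → (∀ e → 0ℚ ≤ ρ e) → weight S ρ ≤ sumFin ρ
weight≤sumFin S 0≤ρ = weight-mono-⊆ {T = λ _ → true} (λ _ _ → refl) (λ e _ → 0≤ρ e)

weight-∅ : ∀ {m} {S : Fin m → Bool} {ρ : Fin m → ℚ} → (∀ e → S e ≡ false) → weight S ρ ≡ 0ℚ
weight-∅ {m} {S} {ρ} S≡∅ = trans (sumFin-cong (λ e → cong (λ b → when b (ρ e)) (S≡∅ e))) (sumFin-zero {m})

weight-∖[] : ∀ {m} (S : Fin m → Bool) (ρ : Fin m → ℚ) {e} → S e ≡ true → weight S ρ ≡ weight (S ∖[ e ]) ρ + ρ e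
weight-∖[] {suc m} S ρ {zero} S0 rewrite S0 = move (ρ zero) (weight (S ∘ suc) (ρ ∘ suc))
  where
  move : ∀ x w → x + w ≡ (0ℚ + w) + x
  move = solve-∀ ℚ-ring
weight-∖[] {suc m} S ρ {suc e} Se =
  trans (cong (head +_) (weight-∖[] (S ∘ suc) (ρ ∘ suc) Se))
        (sym (ℚ.+-assoc head (weight ((S ∘ suc) ∖[ e ]) (ρ ∘ suc)) (ρ (suc e))))
  where
  head : ℚ
  head = when (S zero) (ρ zero)

weight-insert : ∀ {m} (S : Fin m → Bool) (ρ : Fin m → ℚ) {e} → S e ≡ false → weight (insert e S) ρ ≡ weight S ρ + ρ e
weight-insert S ρ {e} Se = begin
  weight (insert e S) ρ                 ≡⟨ weight-∖[] (insert e S) ρ (insert-self S e) ⟩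
  weight (insert e S ∖[ e ]) ρ + ρ e    ≡⟨ cong (_+ ρ e) (sumFin-cong restrict) ⟩
  weight S ρ + ρ e                      ∎
  where
  open ≡-Reasoning
  restrict : ∀ f → when ((insert e S ∖[ e ]) f) (ρ f) ≡ when (S f) (ρ f)
  restrict f = cong (λ b → when b (ρ f)) (insert-∖[] S Se f)

weight-shift : ∀ {m} (S : Fin m → Bool) (ρ : Fin m → ℚ) (t : ℚ) → weight S ρ ≡ weight S (λ e → ρ e - t) + t * ∣ S ∣
weight-shift S ρ t = begin
  weight S ρ                                               ≡⟨ sumFin-cong (λ e → split (S e)) ⟩
  sumFin (λ e → when (S e) (ρ′ e) + t * when (S e) 1ℚ)     ≡⟨ sumFin-+ (λ e → when (S e) (ρ′ e)) (λ e → t * when (S e) 1ℚ) ⟩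
  weight S ρ′ + sumFin (λ e → t * when (S e) 1ℚ)           ≡⟨ cong (weight S ρ′ +_) (sumFin-* t (λ e → when (S e) 1ℚ)) ⟩
  weight S ρ′ + t * ∣ S ∣                                  ∎
  where
  open ≡-Reasoning
  ρ′ : _ → ℚ
  ρ′ e = ρ e - t
  shift : ∀ x t → x ≡ (x - t) + t * 1ℚ
  shift = solve-∀ ℚ-ring
  split : ∀ b {x} → when b x ≡ when b (x - t) + t * when b 1ℚ
  split true  {x} = shift x t
  split false     = trans (sym (ℚ.+-identityˡ 0ℚ)) (cong (0ℚ +_) (sym (ℚ.*-zeroʳ t)))

elements : ∀ {m} → (Fin m → Bool) → List (Fin m)
elements {m} S = filterᵇ S (allFin m)

∈-elements⁺ : ∀ {m} {S : Fin m → Bool} {e} → S e ≡ true → e ∈ elements S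
∈-elements⁺ {m} {S} {e} Se = ∈-filter⁺ (λ f → T? (S f)) {xs = allFin m} (∈-allFin e) (Equivalence.from T-≡ Se)

∈-elements⁻ : ∀ {m} {S : Fin m → Bool} {e} → e ∈ elements S → S e ≡ true
∈-elements⁻ {m} {S} e∈ = Equivalence.to T-≡ (proj₂ (∈-filter⁻ (λ f → T? (S f)) {xs = allFin m} e∈))

sumFin-lookup-filter : ∀ {A : Set} {k} (p : A → Bool) (f : Fin k → A) (g : A → ℚ) →
  sumFin (g ∘ lookup (filterᵇ p (tabulate f))) ≡ sumFin (λ i → when (p (f i)) (g (f i)))
sumFin-lookup-filter {k = zero}  p f g = refl
sumFin-lookup-filter {k = suc k} p f g with p (f zero)
... | true  = cong (g (f zero) +_) (sumFin-lookup-filter p (f ∘ suc) g)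
... | false = trans (sumFin-lookup-filter p (f ∘ suc) g) (sym (ℚ.+-identityˡ _))

sumFin-lookup-elements : ∀ {m} (S : Fin m → Bool) (g : Fin m → ℚ) → sumFin (g ∘ lookup (elements S)) ≡ weight S g
sumFin-lookup-elements S g = sumFin-lookup-filter S (λ i → i) g

lightest : ∀ {m} (S : Fin m → Bool) (ρ : Fin m → ℚ) → Σ (Fin m) (λ e → S e ≡ true) →
  Σ (Fin m) λ e₀ → S e₀ ≡ true × (∀ e → S e ≡ true → ρ e₀ ≤ ρ e)
lightest S ρ (e , Se) =
  argmin ρ e (elements S) ,
  argmin-all ρ {P = λ e → S e ≡ true} Se (All.tabulate (∈-elements⁻ {S = S})) ,
  λ e′ Se′ → All.lookup (f[argmin]≤f[xs] e (elements S)) (∈-elements⁺ Se′)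

src tgt : (K : Graph) → Fin (m K) → Fin (n K)
src K e = proj₁ (ends K e)
tgt K e = proj₂ (ends K e)

module _ {K : Graph} {A : Fin (m K) → Set} where

  Reach-≡ : ∀ {u v} → u ≡ v → Reach K A u v
  Reach-≡ refl = here

  Reach-edge : ∀ e → A e → Reach K A (src K e) (tgt K e)
  Reach-edge e a = fwd e a refl here

  Reach-trans : ∀ {u v w} → Reach K A u v → Reach K A v w → Reach K A u w
  Reach-trans here           r′ = r′
  Reach-trans (fwd e a eq r) r′ = fwd e a eq (Reach-trans r r′)
  Reach-trans (bwd e a eq r) r′ = bwd e a eq (Reach-trans r r′)

  Reach-sym : ∀ {u v} → Reach K A u v → Reach K A v u
  Reach-sym here             = here
  Reach-sym (fwd e a refl r) = Reach-trans (Reach-sym r) (bwd e a refl here)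
  Reach-sym (bwd e a refl r) = Reach-trans (Reach-sym r) (Reach-edge e a)

Reach-image : ∀ {K L : Graph} {A : Fin (m K) → Set} {B : Fin (m L) → Set} (π : Fin (n K) → Fin (n L)) →
  (∀ e → A e → Reach L B (π (src K e)) (π (tgt K e))) → ∀ {u v} → Reach K A u v → Reach L B (π u) (π v)
Reach-image π step here             = here
Reach-image π step (fwd e a refl r) = Reach-trans (step e a) (Reach-image π step r)
Reach-image π step (bwd e a refl r) = Reach-trans (Reach-sym (step e a)) (Reach-image π step r)

module _ {K : Graph} {A B : Fin (m K) → Set} where

  Reach-map : (∀ e → A e → Reach K B (src K e) (tgt K e)) → ∀ {u v} → Reach K A u v → Reach K B u v
  Reach-map = Reach-image (λ v → v)

  Reach-mono : (∀ e → A e → B e) → ∀ {u v} → Reach K A u v → Reach K B u v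
  Reach-mono A⊆B = Reach-map (λ e a → Reach-edge e (A⊆B e a))

module Merge {c : ℕ} {a b : Fin (suc (suc c))} (a≢b : a ≢ b) where

  private
    redirect : Fin (suc (suc c)) → Fin (suc (suc c))
    redirect x with x ≟ b
    ... | yes _ = a
    ... | no  _ = x

    b≢redirect : ∀ x → b ≢ redirect x
    b≢redirect x with x ≟ b
    ... | yes _   = a≢b ∘ sym
    ... | no  x≢b = x≢b ∘ sym

    redirect-≢ : ∀ {x} → x ≢ b → redirect x ≡ x
    redirect-≢ {x} x≢b with x ≟ b
    ... | yes x≡b = ⊥-elim (x≢b x≡b)
    ... | no  _   = refl

    redirect-≡ : ∀ {x} → x ≡ b → redirect x ≡ a
    redirect-≡ {x} x≡b with x ≟ b
    ... | yes _   = refl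
    ... | no  x≢b = ⊥-elim (x≢b x≡b)

  merge : Fin (suc (suc c)) → Fin (suc c)
  merge x = punchOut (b≢redirect x)

  merge-identifies : merge a ≡ merge b
  merge-identifies = Finₚ.punchOut-cong b (trans (redirect-≢ a≢b) (sym (redirect-≡ refl)))

  merge-surjective : ∀ i → Σ (Fin (suc (suc c))) λ x → merge x ≡ i
  merge-surjective i =
    punchIn b i , trans (Finₚ.punchOut-cong b (redirect-≢ (Finₚ.punchInᵢ≢i b i))) (Finₚ.punchOut-punchIn b)

  merge-fibres : ∀ x y → merge x ≡ merge y → x ≡ y ⊎ (x ≡ a × y ≡ b) ⊎ (x ≡ b × y ≡ a)
  merge-fibres x y mx≡my = cases (x ≟ b) (y ≟ b)
    where
    rx≡ry : redirect x ≡ redirect y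
    rx≡ry = Finₚ.punchOut-injective (b≢redirect x) (b≢redirect y) mx≡my
    cases : Dec (x ≡ b) → Dec (y ≡ b) → x ≡ y ⊎ (x ≡ a × y ≡ b) ⊎ (x ≡ b × y ≡ a)
    cases (yes x≡b) (yes y≡b) = inj₁ (trans x≡b (sym y≡b))
    cases (yes x≡b) (no  y≢b) = inj₂ (inj₂ (x≡b , trans (sym (redirect-≢ y≢b)) (trans (sym rx≡ry) (redirect-≡ x≡b))))
    cases (no  x≢b) (yes y≡b) = inj₂ (inj₁ (trans (sym (redirect-≢ x≢b)) (trans rx≡ry (redirect-≡ y≡b)) , y≡b))
    cases (no  x≢b) (no  y≢b) = inj₁ (trans (sym (redirect-≢ x≢b)) (trans rx≡ry (redirect-≢ y≢b)))

module _ (K : Graph) where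

  InClass : ∀ {c} → (Fin (n K) → Fin c) → Fin (m K) → Set
  InClass q e = q (src K e) ≡ q (tgt K e)

  crosses : ∀ {c} → (Fin (n K) → Fin c) → Fin (m K) → Bool
  crosses q e = not (does (q (src K e) ≟ q (tgt K e)))

  Onto : ∀ {c} → (Fin (n K) → Fin c) → Set
  Onto q = ∀ i → Σ (Fin (n K)) λ v → q v ≡ i

  SameConnected : ∀ {c} → (Fin (n K) → Fin c) → Set
  SameConnected q = ∀ u v → q u ≡ q v → Reach K (InClass q) u v

  Joins : ∀ {c} → (Fin (n K) → Fin c) → (Fin (m K) → Bool) → Set
  Joins q S = ConnectedVia K (λ e → S e ≡ true ⊎ InClass q e)

  crosses⇒¬InClass : ∀ {c} (q : Fin (n K) → Fin c) e → crosses q e ≡ true → ¬ InClass q e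
  crosses⇒¬InClass q e cr same with q (src K e) ≟ q (tgt K e)
  crosses⇒¬InClass q e () same | yes _
  ... | no diff = diff same

  ¬InClass⇒crosses : ∀ {c} (q : Fin (n K) → Fin c) e → ¬ InClass q e → crosses q e ≡ true
  ¬InClass⇒crosses q e diff with q (src K e) ≟ q (tgt K e)
  ... | yes same = ⊥-elim (diff same)
  ... | no  _    = refl

  crosses-∘ : ∀ {c c′} (q : Fin (n K) → Fin c) (g : Fin c → Fin c′) e →
    crosses (g ∘ q) e ≡ true → crosses q e ≡ true
  crosses-∘ q g e cr = ¬InClass⇒crosses q e (crosses⇒¬InClass (g ∘ q) e cr ∘ cong g)

  sameConnected⇒partsConnected : ∀ {j} (q : Fin (n K) → Fin (suc (suc j))) → SameConnected q →
    PartsConnected {K} (record { j = j ; part = q })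
  sameConnected⇒partsConnected q conn i u v qu≡i qv≡i = stay (conn u v (trans qu≡i (sym qv≡i))) qu≡i
    where
    stay : ∀ {x y} → Reach K (InClass q) x y → q x ≡ i → Reach K (λ e → q (src K e) ≡ i × q (tgt K e) ≡ i) x y
    stay here                _    = here
    stay (fwd e same refl r) qx≡i = fwd e (qx≡i , trans (sym same) qx≡i) refl (stay r (trans (sym same) qx≡i))
    stay (bwd e same refl r) qx≡i = bwd e (trans same qx≡i , qx≡i) refl (stay r (trans same qx≡i))

  crossing-edge : ∀ {c} (q : Fin (n K) → Fin c) {A u v} → Reach K A u v → q u ≢ q v →
    Σ (Fin (m K)) λ e → A e × crosses q e ≡ true
  crossing-edge q here qu≢qv = ⊥-elim (qu≢qv refl)
  crossing-edge q (fwd e a refl r) qu≢qv with q (src K e) ≟ q (tgt K e)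
  ... | yes same = crossing-edge q r (qu≢qv ∘ trans same)
  ... | no  diff = e , a , ¬InClass⇒crosses q e diff
  crossing-edge q (bwd e a refl r) qu≢qv with q (src K e) ≟ q (tgt K e)
  ... | yes same = crossing-edge q r (qu≢qv ∘ trans (sym same))
  ... | no  diff = e , a , ¬InClass⇒crosses q e diff

  connected⇒crossing-edge : ∀ {c} (q : Fin (n K) → Fin (suc (suc c))) → Onto q → ∀ {A} → ConnectedVia K A →
    Σ (Fin (m K)) λ e → A e × crosses q e ≡ true
  connected⇒crossing-edge q onto conn with onto zero | onto (suc zero)
  ... | u , qu≡0 | v , qv≡1 = crossing-edge q (conn u v) (λ qu≡qv → Finₚ.0≢1+n (trans (sym qu≡0) (trans qu≡qv qv≡1)))

module MergeAlong (K : Graph) {c} (q : Fin (n K) → Fin (suc (suc c)))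
                  (e₀ : Fin (m K)) (e₀-crosses : crosses K q e₀ ≡ true) where

  open Merge (crosses⇒¬InClass K q e₀ e₀-crosses)

  merged : Fin (n K) → Fin (suc c)
  merged = merge ∘ q

  InClass-merged : ∀ {e} → InClass K q e → InClass K merged e
  InClass-merged = cong merge

  e₀-InClass-merged : InClass K merged e₀
  e₀-InClass-merged = merge-identifies

  merged-crosses⇒crosses : ∀ e → crosses K merged e ≡ true → crosses K q e ≡ true
  merged-crosses⇒crosses = crosses-∘ K q merge

  merged-onto : Onto K q → Onto K merged
  merged-onto onto i with merge-surjective i
  ... | x , mx≡i with onto x
  ...   | v , qv≡x = v , trans (cong merge qv≡x) mx≡i

  private
    across-e₀ : SameConnected K q → ∀ {u v} → q u ≡ q (src K e₀) → q v ≡ q (tgt K e₀) →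
      Reach K (λ e → InClass K q e ⊎ e ≡ e₀) u v
    across-e₀ conn {u} {v} qu≡a qv≡b =
      Reach-trans (Reach-mono (λ _ → inj₁) (conn u (src K e₀) qu≡a))
        (Reach-trans (Reach-edge e₀ (inj₂ refl)) (Reach-mono (λ _ → inj₁) (conn (tgt K e₀) v (sym qv≡b))))

  merged-classes-joined-by-e₀ : SameConnected K q → ∀ u v → merged u ≡ merged v →
    Reach K (λ e → InClass K q e ⊎ e ≡ e₀) u v
  merged-classes-joined-by-e₀ conn u v eq with merge-fibres (q u) (q v) eq
  ... | inj₁ qu≡qv                = Reach-mono (λ _ → inj₁) (conn u v qu≡qv)
  ... | inj₂ (inj₁ (qu≡a , qv≡b)) = across-e₀ conn qu≡a qv≡b
  ... | inj₂ (inj₂ (qu≡b , qv≡a)) = Reach-sym (across-e₀ conn qv≡a qu≡b)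

  merged-sameConnected : SameConnected K q → SameConnected K merged
  merged-sameConnected conn u v eq = Reach-mono InClass-or-e₀ (merged-classes-joined-by-e₀ conn u v eq)
    where
    InClass-or-e₀ : ∀ e → InClass K q e ⊎ e ≡ e₀ → InClass K merged e
    InClass-or-e₀ e (inj₁ same) = InClass-merged same
    InClass-or-e₀ e (inj₂ refl) = e₀-InClass-merged

  joins-∖[e₀] : ∀ S → Joins K q S → Joins K merged (S ∖[ e₀ ])
  joins-∖[e₀] S joins u v = Reach-mono step (joins u v)
    where
    step : ∀ f → S f ≡ true ⊎ InClass K q f → (S ∖[ e₀ ]) f ≡ true ⊎ InClass K merged f
    step f (inj₂ same) = inj₂ (InClass-merged same)
    step f (inj₁ Sf) with f ≟ e₀
    ... | yes refl = inj₂ e₀-InClass-merged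
    ... | no  _    = inj₁ Sf

  joins-insert-e₀ : SameConnected K q → ∀ S → Joins K merged S → Joins K q (insert e₀ S)
  joins-insert-e₀ conn S joins u v = Reach-map step (joins u v)
    where
    via-e₀ : ∀ f → InClass K q f ⊎ f ≡ e₀ → insert e₀ S f ≡ true ⊎ InClass K q f
    via-e₀ f (inj₁ same) = inj₂ same
    via-e₀ f (inj₂ refl) = inj₁ (insert-self S e₀)
    step : ∀ f → S f ≡ true ⊎ InClass K merged f →
      Reach K (λ f → insert e₀ S f ≡ true ⊎ InClass K q f) (src K f) (tgt K f)
    step f (inj₁ Sf)   = Reach-edge f (inj₁ (insert-⊇ S e₀ Sf))
    step f (inj₂ same) = Reach-mono via-e₀ (merged-classes-joined-by-e₀ conn (src K f) (tgt K f) same)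

  module _ (S : Fin (m K) → Bool) (S-crossing : ∀ e → S e ≡ true → crosses K merged e ≡ true) where

    e₀∉crossing : S e₀ ≡ false
    e₀∉crossing = ¬-not (λ Se₀ → crosses⇒¬InClass K merged e₀ (S-crossing e₀ Se₀) e₀-InClass-merged)

    insert-e₀-crossing : ∀ e → insert e₀ S e ≡ true → crosses K q e ≡ true
    insert-e₀-crossing e ins with insert⁻ S e₀ ins
    ... | inj₁ refl = e₀-crosses
    ... | inj₂ Se   = merged-crosses⇒crosses e (S-crossing e Se)

module _ (K : Graph) where

  JoiningSetsLarge : ℕ → Set
  JoiningSetsLarge c = ∀ (q : Fin (n K) → Fin c) → Onto K q → ∀ S → Joins K q S → fromℕ (pred c) ≤ ∣ S ∣

  joining-sets-large-step : ∀ {c} → JoiningSetsLarge (suc c) → JoiningSetsLarge (suc (suc c))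
  joining-sets-large-step {c} IH q onto S joins with connected⇒crossing-edge K q onto joins
  ... | e₀ , inj₂ e₀-inClass , e₀-crosses = ⊥-elim (crosses⇒¬InClass K q e₀ e₀-crosses e₀-inClass)
  ... | e₀ , inj₁ S-e₀       , e₀-crosses = begin
    fromℕ (suc c)        ≡⟨ trans (fromℕ-suc c) (ℚ.+-comm 1ℚ (fromℕ c)) ⟩
    fromℕ c + 1ℚ         ≤⟨ ℚ.+-monoˡ-≤ 1ℚ (IH merged (merged-onto onto) (S ∖[ e₀ ]) (joins-∖[e₀] S joins)) ⟩
    ∣ S ∖[ e₀ ] ∣ + 1ℚ   ≡⟨ weight-∖[] S (λ _ → 1ℚ) S-e₀ ⟨
    ∣ S ∣                ∎
    where
    open MergeAlong K q e₀ e₀-crosses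
    open ℚ.≤-Reasoning

  joining-sets-large : ∀ c → JoiningSetsLarge c
  joining-sets-large zero          _ _ S _ = 0≤∣ S ∣
  joining-sets-large (suc zero)    _ _ S _ = 0≤∣ S ∣
  joining-sets-large (suc (suc c)) = joining-sets-large-step (joining-sets-large (suc c))

  spanning-tree-size : ∀ T → IsSpanningTree K T → fromℕ (pred (n K)) ≤ ∣ T ∣
  spanning-tree-size T (T-connected , _) =
    joining-sets-large (n K) (λ v → v) (λ i → i , refl) T (λ u v → Reach-mono (λ _ → inj₁) (T-connected u v))

  reciprocal-admissible : .{{_ : NonZero (pred (n K))}} → Adm (SpanningTrees K) (λ _ → ℤ.+ 1 / pred (n K))
  reciprocal-admissible = (λ _ → 0≤u) , λ (T , T-tree) → begin
    1ℚ                                 ≡⟨ 1/k*k≡1 (pred (n K)) ⟨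
    u * fromℕ (pred (n K))             ≤⟨ *-monoˡ-≤-0≤ 0≤u (spanning-tree-size T T-tree) ⟩
    u * ∣ T ∣                          ≡⟨ sumFin-* u (λ f → when (T f) 1ℚ) ⟨
    sumFin (λ f → u * when (T f) 1ℚ)   ≡⟨ sumFin-cong (λ f → ℚ.*-comm u (when (T f) 1ℚ)) ⟩
    sumFin (λ f → indicator T f * u)   ∎
    where
    open ℚ.≤-Reasoning
    u : ℚ
    u = ℤ.+ 1 / pred (n K)
    0≤u : 0ℚ ≤ u
    0≤u = 0≤1/k (pred (n K))

partition-bound : ∀ {K : Graph} {M : ℚ} → Adm (Φ K) (λ _ → M) → (Q : Partition K) → Feasible {K} Q →
  fromℕ (suc (j Q)) ≤ M * ∣ isCut {K} Q ∣
partition-bound {K} {M} (_ , M-admissible) Q Q-feasible = begin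
  k                                         ≡⟨ ℚ.*-identityʳ k ⟨
  k * 1ℚ                                    ≤⟨ *-monoˡ-≤-0≤ (0≤fromℕ (suc (j Q))) (M-admissible (Q , Q-feasible)) ⟩
  k * sumFin (λ e → usageP {K} Q e * M)     ≡⟨ cong (k *_) usage-total ⟩
  k * (u * (M * ∣ isCut {K} Q ∣))           ≡⟨ reassociate k u (M * ∣ isCut {K} Q ∣) ⟩
  (u * k) * (M * ∣ isCut {K} Q ∣)           ≡⟨ cong (_* (M * ∣ isCut {K} Q ∣)) (1/k*k≡1 (suc (j Q))) ⟩
  1ℚ * (M * ∣ isCut {K} Q ∣)                ≡⟨ ℚ.*-identityˡ _ ⟩
  M * ∣ isCut {K} Q ∣                       ∎
  where
  open ℚ.≤-Reasoning
  k u : ℚ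
  k = fromℕ (suc (j Q))
  u = ℤ.+ 1 / suc (j Q)
  reassociate : ∀ k u x → k * (u * x) ≡ (u * k) * x
  reassociate = solve-∀ ℚ-ring
  on-cut : ∀ u M → u * M ≡ u * (M * 1ℚ)
  on-cut = solve-∀ ℚ-ring
  off-cut : ∀ u M → 0ℚ * M ≡ u * (M * 0ℚ)
  off-cut = solve-∀ ℚ-ring
  pointwise : ∀ b → when b u * M ≡ u * (M * when b 1ℚ)
  pointwise true  = on-cut u M
  pointwise false = off-cut u M
  usage-total : sumFin (λ e → usageP {K} Q e * M) ≡ u * (M * ∣ isCut {K} Q ∣)
  usage-total = begin-equality
    sumFin (λ e → usageP {K} Q e * M)                  ≡⟨ sumFin-cong (λ e → pointwise (isCut {K} Q e)) ⟩
    sumFin (λ e → u * (M * when (isCut {K} Q e) 1ℚ))   ≡⟨ sumFin-* u (λ e → M * when (isCut {K} Q e) 1ℚ) ⟩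
    u * sumFin (λ e → M * when (isCut {K} Q e) 1ℚ)     ≡⟨ cong (u *_) (sumFin-* M (λ e → when (isCut {K} Q e) 1ℚ)) ⟩
    u * (M * ∣ isCut {K} Q ∣)                          ∎

greedy-estimate : ∀ {M t A B B′ N N′ : ℚ} {k} → 0ℚ ≤ M → 0ℚ ≤ t →
  A ≤ M * B′ → B′ ≤ B → N′ ≤ fromℕ k → fromℕ (suc k) ≤ M * N →
  (A + t * N′) + t ≤ M * (B + t * N)
greedy-estimate {M} {t} {A} {B} {B′} {N} {N′} {k} 0≤M 0≤t A≤MB′ B′≤B N′≤k k+1≤MN = begin
  (A + t * N′) + t             ≤⟨ ℚ.+-monoˡ-≤ t (ℚ.+-mono-≤ A≤MB (*-monoˡ-≤-0≤ 0≤t N′≤k)) ⟩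
  (M * B + t * fromℕ k) + t    ≡⟨ collect (M * B) t (fromℕ k) ⟩
  M * B + t * (1ℚ + fromℕ k)   ≡⟨ cong (λ x → M * B + t * x) (fromℕ-suc k) ⟨
  M * B + t * fromℕ (suc k)    ≤⟨ ℚ.+-monoʳ-≤ (M * B) (*-monoˡ-≤-0≤ 0≤t k+1≤MN) ⟩
  M * B + t * (M * N)          ≡⟨ factor M B t N ⟩
  M * (B + t * N)              ∎
  where
  open ℚ.≤-Reasoning
  A≤MB : A ≤ M * B
  A≤MB = ℚ.≤-trans A≤MB′ (*-monoˡ-≤-0≤ 0≤M B′≤B)
  collect : ∀ x t y → (x + t * y) + t ≡ x + t * (1ℚ + y)
  collect = solve-∀ ℚ-ring
  factor : ∀ M B t N → M * B + t * (M * N) ≡ M * (B + t * N)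
  factor = solve-∀ ℚ-ring

module Greedy (K : Graph) (K-connected : Connected K) {M : ℚ} (M-admissible : Adm (Φ K) (λ _ → M)) where

  record LightConnector {c} (q : Fin (n K) → Fin c) (ρ : Fin (m K) → ℚ) : Set where
    field
      edges    : Fin (m K) → Bool
      crossing : ∀ e → edges e ≡ true → crosses K q e ≡ true
      joins    : Joins K q edges
      small    : ∣ edges ∣ ≤ fromℕ (pred c)
      light    : weight edges ρ ≤ M * weight (crosses K q) ρ

  HasLightConnectors : ℕ → Set
  HasLightConnectors c = ∀ (q : Fin (n K) → Fin c) → Onto K q → SameConnected K q →
    ∀ ρ → (∀ e → crosses K q e ≡ true → 0ℚ ≤ ρ e) → LightConnector q ρ

  single-class : ∀ {c} (q : Fin (n K) → Fin c) → (∀ u v → q u ≡ q v) → SameConnected K q →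
    ∀ ρ → LightConnector q ρ
  single-class {c} q all-same conn ρ = record
    { edges    = λ _ → false
    ; crossing = λ _ ()
    ; joins    = λ u v → Reach-mono (λ _ → inj₂) (conn u v (all-same u v))
    ; small    = ℚ.≤-trans (ℚ.≤-reflexive (weight-∅ {m K} {ρ = λ _ → 1ℚ} (λ _ → refl))) (0≤fromℕ (pred c))
    ; light    = ℚ.≤-reflexive (begin
        weight (λ _ → false) ρ       ≡⟨ weight-∅ {m K} {ρ = ρ} (λ _ → refl) ⟩
        0ℚ                           ≡⟨ ℚ.*-zeroʳ M ⟨
        M * 0ℚ                       ≡⟨ cong (M *_) (weight-∅ no-crossing) ⟨
        M * weight (crosses K q) ρ   ∎)
    }
    where
    open ≡-Reasoning
    no-crossing : ∀ e → crosses K q e ≡ false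
    no-crossing e = ¬-not (λ cr → crosses⇒¬InClass K q e cr (all-same _ _))

  -- Kruskal on the classes of q: take the lightest crossing edge e₀, merge its two classes and
  -- recurse on ρ - ρ e₀.  Passing back to ρ costs ρ e₀ per connector edge, at most k_q - 1 of
  -- them, and the partition inequality k_q - 1 ≤ M |E_q| for q pays for that.
  light-connector-step : ∀ {c} → HasLightConnectors (suc c) → HasLightConnectors (suc (suc c))
  light-connector-step {c} IH q onto conn ρ 0≤ρ
    with (e , _ , e-crosses) ← connected⇒crossing-edge K q onto K-connected
    with (e₀ , e₀-crosses , e₀-lightest) ← lightest (crosses K q) ρ (e , e-crosses) = record
    { edges    = insert e₀ S′
    ; crossing = insert-e₀-crossing S′ S′-crossing
    ; joins    = joins-insert-e₀ conn S′ S′-joins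
    ; small    = small
    ; light    = light
    }
    where
    open MergeAlong K q e₀ e₀-crosses
    open ℚ.≤-Reasoning
    t : ℚ
    t = ρ e₀
    ρ′ : Fin (m K) → ℚ
    ρ′ e = ρ e - t
    0≤ρ′ : ∀ e → crosses K q e ≡ true → 0ℚ ≤ ρ′ e
    0≤ρ′ e cr = p≤q⇒0≤q-p (e₀-lightest e cr)
    C′ : LightConnector merged ρ′
    C′ = IH merged (merged-onto onto) (merged-sameConnected conn) ρ′ (λ e cr → 0≤ρ′ e (merged-crosses⇒crosses e cr))
    open LightConnector C′ using ()
      renaming (edges to S′; crossing to S′-crossing; joins to S′-joins; small to S′-small; light to S′-light)
    small : ∣ insert e₀ S′ ∣ ≤ fromℕ (suc c)
    small = begin
      ∣ insert e₀ S′ ∣   ≡⟨ weight-insert S′ (λ _ → 1ℚ) (e₀∉crossing S′ S′-crossing) ⟩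
      ∣ S′ ∣ + 1ℚ        ≤⟨ ℚ.+-monoˡ-≤ 1ℚ S′-small ⟩
      fromℕ c + 1ℚ       ≡⟨ trans (ℚ.+-comm (fromℕ c) 1ℚ) (sym (fromℕ-suc c)) ⟩
      fromℕ (suc c)      ∎
    light : weight (insert e₀ S′) ρ ≤ M * weight (crosses K q) ρ
    light = begin
      weight (insert e₀ S′) ρ                               ≡⟨ weight-insert S′ ρ (e₀∉crossing S′ S′-crossing) ⟩
      weight S′ ρ + t                                       ≡⟨ cong (_+ t) (weight-shift S′ ρ t) ⟩
      (weight S′ ρ′ + t * ∣ S′ ∣) + t                       ≤⟨ greedy-estimate {k = c} (proj₁ M-admissible e₀) (0≤ρ e₀ e₀-crosses)
                                                                 S′-light (weight-mono-⊆ merged-crosses⇒crosses 0≤ρ′) S′-small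
                                                                 (partition-bound M-admissible (record { j = c ; part = q })
                                                                   (onto , sameConnected⇒partsConnected K q conn)) ⟩
      M * (weight (crosses K q) ρ′ + t * ∣ crosses K q ∣)   ≡⟨ cong (M *_) (weight-shift (crosses K q) ρ t) ⟨
      M * weight (crosses K q) ρ                            ∎

  light-connectors : ∀ c → HasLightConnectors c
  light-connectors zero          q _ conn ρ _ = single-class q (λ u → ⊥-elim (Finₚ.¬Fin0 (q u))) conn ρ
  light-connectors (suc zero)    q _ conn ρ _ = single-class q (λ u v → Fin1-unique (q u) (q v)) conn ρ
    where
    Fin1-unique : (x y : Fin 1) → x ≡ y
    Fin1-unique zero zero = refl
  light-connectors (suc (suc c)) = light-connector-step (light-connectors (suc c))

  light-spanning-tree : 0ℚ ≤ M → ∀ ρ → (∀ e → 0ℚ ≤ ρ e) →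
    Σ (Fin (m K) → Bool) λ T → IsSpanningTree K T × weight T ρ ≤ M * sumFin ρ
  light-spanning-tree 0≤M ρ 0≤ρ = T , (T-connected , T-minimal) , T-light
    where
    C : LightConnector (λ v → v) ρ
    C = light-connectors (n K) (λ v → v) (λ i → i , refl) (λ u v → Reach-≡) ρ (λ e _ → 0≤ρ e)
    open LightConnector C renaming (edges to T)
    T-connected : ConnectedVia K (InSet T)
    T-connected u v = Reach-map step (joins u v)
      where
      step : ∀ e → T e ≡ true ⊎ InClass K (λ v → v) e → Reach K (InSet T) (src K e) (tgt K e)
      step e (inj₁ Te)   = Reach-edge e Te
      step e (inj₂ loop) = Reach-≡ loop
    -- No edge can be dropped: T has at most |V| - 1 edges, and every joining set at least |V| - 1.
    T-minimal : ∀ e → T e ≡ true → ¬ ConnectedVia K (InSetMinus T e)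
    T-minimal e Te T∖e-connected = p+1≰p ∣ T ∖[ e ] ∣ (begin
      ∣ T ∖[ e ] ∣ + 1ℚ    ≡⟨ weight-∖[] T (λ _ → 1ℚ) Te ⟨
      ∣ T ∣                ≤⟨ small ⟩
      fromℕ (pred (n K))   ≤⟨ joining-sets-large K (n K) (λ v → v) (λ i → i , refl) (T ∖[ e ]) T∖e-joins ⟩
      ∣ T ∖[ e ] ∣         ∎)
      where
      open ℚ.≤-Reasoning
      T∖e-joins : Joins K (λ v → v) (T ∖[ e ])
      T∖e-joins u v = Reach-mono (λ f (Tf , f≢e) → inj₁ (trans (∖[]-≢ T f≢e) Tf)) (T∖e-connected u v)
    T-light : weight T ρ ≤ M * sumFin ρ
    T-light = ℚ.≤-trans light (*-monoˡ-≤-0≤ 0≤M (weight≤sumFin (crosses K (λ v → v)) 0≤ρ))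

  1≤M*sumFin : 0ℚ ≤ M → ∀ {ρ} → Adm (SpanningTrees K) ρ → 1ℚ ≤ M * sumFin ρ
  1≤M*sumFin 0≤M {ρ} (0≤ρ , ρ-admissible) with (T , T-tree , T-light) ← light-spanning-tree 0≤M ρ 0≤ρ = begin
    1ℚ                                   ≤⟨ ρ-admissible (T , T-tree) ⟩
    sumFin (λ e → indicator T e * ρ e)   ≡⟨ sumFin-cong (λ e → when-1-* (T e)) ⟩
    weight T ρ                           ≤⟨ T-light ⟩
    M * sumFin ρ                         ∎
    where open ℚ.≤-Reasoning

homogeneous-criterion : (K : Graph) → Connected K → .{{_ : NonZero (pred (n K))}} → (M : ℚ) →
  Adm (Φ K) (λ _ → M) → sumFin {m K} (λ _ → M) ≡ fromℕ (pred (n K)) → Homogeneous K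
homogeneous-criterion K K-connected M M-admissible M-tight ρ ρ-optimal e e′ = trans (ρ≡u e) (sym (ρ≡u e′))
  where
  open Greedy K K-connected M-admissible
  open ℚ.≤-Reasoning
  k : ℕ
  k = pred (n K)
  u U R : ℚ
  u = ℤ.+ 1 / k
  U = sumFin {m K} (λ _ → u)
  R = sumFin ρ
  0≤u : 0ℚ ≤ u
  0≤u = 0≤1/k k
  M*U≡1 : M * U ≡ 1ℚ
  M*U≡1 = begin-equality
    M * U                        ≡⟨ sumFin-* {m K} M (λ _ → u) ⟨
    sumFin {m K} (λ _ → M * u)   ≡⟨ sumFin-cong {m K} (λ _ → ℚ.*-comm M u) ⟩
    sumFin {m K} (λ _ → u * M)   ≡⟨ sumFin-* {m K} u (λ _ → M) ⟩
    u * sumFin {m K} (λ _ → M)   ≡⟨ cong (u *_) M-tight ⟩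
    u * fromℕ k                  ≡⟨ 1/k*k≡1 k ⟩
    1ℚ                           ∎
  rearrange : ∀ u U M R → (u * U) * (M * R) ≡ (u * R) * (M * U)
  rearrange = solve-∀ ℚ-ring
  energy-u≤u*R : energy {m K} (λ _ → u) ≤ u * R
  energy-u≤u*R = begin
    energy {m K} (λ _ → u)   ≡⟨ sumFin-* {m K} u (λ _ → u) ⟩
    u * U                    ≡⟨ ℚ.*-identityʳ (u * U) ⟨
    (u * U) * 1ℚ             ≤⟨ *-monoˡ-≤-0≤ (0≤p*q 0≤u (sumFin-nonNeg {m K} (λ _ → 0≤u)))
                                  (1≤M*sumFin (proj₁ M-admissible e) (proj₁ ρ-optimal)) ⟩
    (u * U) * (M * R)        ≡⟨ rearrange u U M R ⟩
    (u * R) * (M * U)        ≡⟨ cong ((u * R) *_) M*U≡1 ⟩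
    (u * R) * 1ℚ             ≡⟨ ℚ.*-identityʳ (u * R) ⟩
    u * R                    ∎
  ρ≡u : ∀ f → ρ f ≡ u
  ρ≡u = constant-of-energy≤ ρ u (proj₂ ρ-optimal (λ _ → u) (reciprocal-admissible K)) energy-u≤u*R

Adm-cong : ∀ {m} (F : Family m) {ρ ρ′ : Fin m → ℚ} → (∀ e → ρ e ≡ ρ′ e) → Adm F ρ → Adm F ρ′
Adm-cong F ρ≗ρ′ (0≤ρ , ρ-admissible) =
  (λ e → subst (0ℚ ≤_) (ρ≗ρ′ e) (0≤ρ e)) ,
  (λ γ → subst (1ℚ ≤_) (sumFin-cong (λ e → cong (usage F γ e *_) (ρ≗ρ′ e))) (ρ-admissible γ))

module Shrink (G : Graph) (P : Partition G) where

  private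
    H : Graph
    H = shrink G P

  cutEdge : Fin (m H) → Fin (m G)
  cutEdge = lookup (cutList {G} P)

  cutEdge-isCut : ∀ h → isCut {G} P (cutEdge h) ≡ true
  cutEdge-isCut h = ∈-elements⁻ {S = isCut {G} P} (∈-lookup h)

  cutEdge-onto : ∀ f → isCut {G} P f ≡ true → Σ (Fin (m H)) λ h → cutEdge h ≡ f
  cutEdge-onto f f-cut = index f∈ , sym (lookup-index f∈)
    where
    f∈ : f ∈ cutList {G} P
    f∈ = ∈-elements⁺ f-cut

  sumFin-cutEdge : ∀ g → sumFin (g ∘ cutEdge) ≡ weight (isCut {G} P) g
  sumFin-cutEdge = sumFin-lookup-elements (isCut {G} P)

  shrink-connected : Surjective {G} P → Connected G → Connected H
  shrink-connected P-onto G-connected x y with P-onto x | P-onto y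
  ... | u , refl | v , refl = Reach-image (part P) edge-image (G-connected u v)
    where
    edge-image : ∀ f → AllEdges {G} f → Reach H (AllEdges {H}) (part P (src G f)) (part P (tgt G f))
    edge-image f _ with part P (src G f) ≟ part P (tgt G f)
    ... | yes same = Reach-≡ same
    ... | no  diff with cutEdge-onto f (¬InClass⇒crosses G (part P) f diff)
    ...   | h , refl = Reach-edge h _

  lift : Partition H → Partition G
  lift Q = record { j = j Q ; part = part Q ∘ part P }

  lift-feasible : Feasible {G} P → ∀ Q → Feasible {H} Q → Feasible {G} (lift Q)
  lift-feasible (P-onto , P-connected) Q (Q-onto , Q-connected) = lift-onto , lift-connected
    where
    lift-onto : Surjective {G} (lift Q)
    lift-onto i with Q-onto i
    ... | x , Qx≡i with P-onto x
    ...   | v , Pv≡x = v , trans (cong (part Q) Pv≡x) Qx≡i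
    inside : ∀ {i x} → part Q x ≡ i → ∀ f → Internal {G} P x f → Internal {G} (lift Q) i f
    inside Qx≡i f (Pa≡x , Pb≡x) = trans (cong (part Q) Pa≡x) Qx≡i , trans (cong (part Q) Pb≡x) Qx≡i
    lift-path : ∀ {i x y w w′} → Reach H (Internal {H} Q i) x y → part Q x ≡ i →
      part P w ≡ x → part P w′ ≡ y → Reach G (Internal {G} (lift Q) i) w w′
    lift-path here Qx≡i Pw≡x Pw′≡x = Reach-mono (inside Qx≡i) (P-connected _ _ _ Pw≡x Pw′≡x)
    lift-path (fwd h (Qa≡i , Qb≡i) refl r) Qx≡i Pw≡x Pw′≡y =
      Reach-trans (Reach-mono (inside Qx≡i) (P-connected _ _ (src G (cutEdge h)) Pw≡x refl))
        (fwd (cutEdge h) (Qa≡i , Qb≡i) refl (lift-path r Qb≡i refl Pw′≡y))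
    lift-path (bwd h (Qa≡i , Qb≡i) refl r) Qx≡i Pw≡x Pw′≡y =
      Reach-trans (Reach-mono (inside Qx≡i) (P-connected _ _ (tgt G (cutEdge h)) Pw≡x refl))
        (bwd (cutEdge h) (Qa≡i , Qb≡i) refl (lift-path r Qa≡i refl Pw′≡y))
    lift-connected : PartsConnected {G} (lift Q)
    lift-connected i u v Qu≡i Qv≡i = lift-path (Q-connected i (part P u) (part P v) Qu≡i Qv≡i) Qu≡i refl refl

  shrink-admissible : Feasible {G} P → ∀ {ρ} → Adm (Φ G) ρ → Adm (Φ H) (ρ ∘ cutEdge)
  shrink-admissible P-feasible {ρ} (0≤ρ , ρ-admissible) = 0≤ρ ∘ cutEdge , λ (Q , Q-feasible) → begin
    1ℚ                                                         ≤⟨ ρ-admissible (lift Q , lift-feasible P-feasible Q Q-feasible) ⟩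
    sumFin (λ f → usageP {G} (lift Q) f * ρ f)                 ≡⟨ sumFin-cong (only-cut-edges Q) ⟩
    weight (isCut {G} P) (λ f → usageP {G} (lift Q) f * ρ f)   ≡⟨ sumFin-cutEdge (λ f → usageP {G} (lift Q) f * ρ f) ⟨
    sumFin (λ h → usageP {H} Q h * ρ (cutEdge h))              ∎
    where
    open ℚ.≤-Reasoning
    restrict : ∀ b {b′ x y} → (b′ ≡ true → b ≡ true) → when b′ x * y ≡ when b (when b′ x * y)
    restrict true                  _    = refl
    restrict false {true}          b′⇒b with () ← b′⇒b refl
    restrict false {false} {y = y} _    = ℚ.*-zeroˡ y
    only-cut-edges : ∀ Q f → usageP {G} (lift Q) f * ρ f ≡ when (isCut {G} P f) (usageP {G} (lift Q) f * ρ f)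
    only-cut-edges Q f = restrict (isCut {G} P f) (crosses-∘ G (part P) (part Q) f)

mainTheorem8 : (G : Graph) → NoSelfLoops G → Connected G →
    (η : Fin (m G) → ℚ) → IsOptimal (Φ G) η →
    (P : Partition G) → Feasible {G} P → Beurling {G} η P →
    (∀ e → (InCut {G} P e → InEmax {G} η e) × (InEmax {G} η e → InCut {G} P e)) →
    Homogeneous (shrink G P)
mainTheorem8 G _ G-connected η (η-admissible , _) P P-feasible P-beurling cut⇔max ρ ρ-optimal e =
  homogeneous-criterion (shrink G P) (shrink-connected (proj₁ P-feasible) G-connected)
    M M-admissible M-tight ρ ρ-optimal e
  where
  open Shrink G P
  M : ℚ
  M = η (cutEdge e)
  η≡M : ∀ h → η (cutEdge h) ≡ M
  η≡M h = ℚ.≤-antisym (proj₁ (cut⇔max _) (cutEdge-isCut e) _) (proj₁ (cut⇔max _) (cutEdge-isCut h) _)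
  M-admissible : Adm (Φ (shrink G P)) (λ _ → M)
  M-admissible = Adm-cong (Φ (shrink G P)) η≡M (shrink-admissible P-feasible η-admissible)
  M-tight : sumFin {m (shrink G P)} (λ _ → M) ≡ fromℕ (suc (j P))
  M-tight = trans (sym (sumFin-cong η≡M)) (trans (sumFin-cutEdge η) P-beurling)
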